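{- Let $K$ be a commutative ring, let $F$ be a free group on finitely many generators, and let $M=(M_{i,j})$ be a $d\times d$ matrix with entries in the group algebra $KF$. Let $A$ be the finite alphabet of all triples $[g,i,j]$ with $1\leq i,j\leq d$, $g\in F$ and $(M_{i,j},g)\neq0$. Define $S_M\in K\langle\langle A\rangle\rangle$ by $(S_M,1)=d$ and, for $w=[g_1,i_1,j_1]\cdots[g_n,i_n,j_n]\in A^+$, $(S_M,w)=(M_{i_1,j_1},g_1)\cdots(M_{i_n,j_n},g_n)$ if (a) $j_n=i_1$ and $j_k=i_{k+1}$ for all $k=1,\ldots,n-1$, and (b) $g_1\cdots g_n=1$ in $F$; and $(S_M,w)=0$ otherwise. Then $S_M$ is cyclic.
   Context: For $a\in KF$ write $a=\sum_{g\in F}(a,g)g$. $A^*$ is the free monoid on $A$, $A^+=A^*\setminus\{1\}$, and a series is written $S=\sum_{w\in A^*}(S,w)w$. A series $S\in K\langle\langle A\rangle\rangle$ is cyclic if (i) $(S,uv)=(S,vu)$ for all $u,v\in A^*$, and (ii) $(S,w^r)=(S,w)^r$ for all $w\in A^+$ and all $r\geq2$. -}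

module Defs where

open import Level using (Level; _⊔_)
open import Algebra.Bundles using (CommutativeRing)
open import Data.Nat as ℕ using (ℕ; zero; suc; _≤_)
open import Data.Fin as Fin using (Fin)
import Data.Fin.Properties as FinP
open import Data.Bool as Bool using (Bool; true; false; _∧_; not; if_then_else_)
import Data.Bool.Properties as BoolP
import Data.Product.Properties
import Relation.Nullary
open import Data.Product using (Σ; Σ-syntax; _×_; _,_; proj₁; proj₂)
open import Data.List using (List; []; _∷_; _++_; concat; replicate; foldr)
import Data.List.Properties as ListP
open import Data.List.Membership.Propositional using (_∈_)
open import Relation.Nullary using (¬_; does)
open import Relation.Binary.PropositionalEquality using (_≡_; _≢_)

-- A letter (i , b) stands for x_i if b = true and x_i⁻¹ if b = false.
-- Group elements are freely reduced words; the product is concatenation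
-- followed by free reduction.

Letter : ℕ → Set
Letter n = Fin n × Bool

cancels : ∀ {n} → Letter n → Letter n → Bool
cancels (i , b) (j , c) = does (i FinP.≟ j) ∧ not (does (b BoolP.≟ c))

push : ∀ {n} → Letter n → List (Letter n) → List (Letter n)
push x [] = x ∷ []
push x (y ∷ ys) = if cancels x y then ys else x ∷ y ∷ ys

reduce : ∀ {n} → List (Letter n) → List (Letter n)
reduce = foldr push []

FreeGroup : ℕ → Set
FreeGroup n = Σ[ w ∈ List (Letter n) ] reduce w ≡ w

word : ∀ {n} → FreeGroup n → List (Letter n)
word = proj₁

prodWord : ∀ {n} → List (FreeGroup n) → List (Letter n)
prodWord [] = []
prodWord (g ∷ gs) = word g ++ prodWord gs

ProdIsOne : ∀ {n} → List (FreeGroup n) → Set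
ProdIsOne gs = reduce (prodWord gs) ≡ []

module _ {c ℓ : Level} (K : CommutativeRing c ℓ) where
  open CommutativeRing K

  -- the group algebra KF: finitely supported functions F → K,
  -- a = Σ_g (a , g) g
  record GroupAlgebra (n : ℕ) : Set (c ⊔ ℓ) where
    field
      coeff   : FreeGroup n → Carrier
      support : List (FreeGroup n)
      finite  : ∀ g → ¬ (coeff g ≈ 0#) → g ∈ support
  open GroupAlgebra public

  -- d × d matrices over KF (indices 0 … d-1 instead of 1 … d)
  Matrix : ℕ → ℕ → Set (c ⊔ ℓ)
  Matrix n d = Fin d → Fin d → GroupAlgebra n

  Alphabet : ∀ {n d} → Matrix n d → Set ℓ
  Alphabet {n} {d} M =
    Σ[ t ∈ FreeGroup n × Fin d × Fin d ]
      (let (g , i , j) = t in ¬ (coeff (M i j) g ≈ 0#))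

  natK : ℕ → Carrier
  natK zero = 0#
  natK (suc m) = 1# + natK m

  powK : Carrier → ℕ → Carrier
  powK x zero = 1#
  powK x (suc r) = x * powK x r

  IsCyclic : ∀ {b} {B : Set b} → (List B → Carrier) → Set (b ⊔ ℓ)
  IsCyclic {B = B} S =
    (∀ (u v : List B) → S (u ++ v) ≈ S (v ++ u)) ×
    (∀ (w : List B) → w ≢ [] → ∀ (r : ℕ) → 2 ≤ r →
       S (concat (replicate r w)) ≈ powK (S w) r)

  module _ {n d : ℕ} (M : Matrix n d) where
    private
      A = Alphabet M
      gOf : A → FreeGroup n
      gOf ((g , _ , _) , _) = g
      iOf : A → Fin d
      iOf ((_ , i , _) , _) = i
      jOf : A → Fin d
      jOf ((_ , _ , j) , _) = j

    closedFrom : Fin d → List A → Bool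
    closedFrom i₁ [] = true
    closedFrom i₁ (x ∷ []) = does (jOf x FinP.≟ i₁)
    closedFrom i₁ (x ∷ y ∷ rest) =
      does (jOf x FinP.≟ iOf y) ∧ closedFrom i₁ (y ∷ rest)

    groupElems : List A → List (FreeGroup n)
    groupElems [] = []
    groupElems (x ∷ xs) = gOf x ∷ groupElems xs

    coeffProd : List A → Carrier
    coeffProd [] = 1#
    coeffProd (x ∷ xs) = coeff (M (iOf x) (jOf x)) (gOf x) * coeffProd xs

    S : List A → Carrier
    S [] = natK d
    S (x ∷ xs) with closedFrom (iOf x) (x ∷ xs)
                  | ListP.≡-dec (Data.Product.Properties.≡-dec FinP._≟_ BoolP._≟_)
                      (reduce (prodWord (groupElems (x ∷ xs)))) []
    ... | true  | Relation.Nullary.yes _ = coeffProd (x ∷ xs)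
    ... | _     | _ = 0#

module Submission where

-- Condition (a) only depends on the cyclic sequence of indices, and for
-- condition (b) g h = 1 forces h = g⁻¹ and hence h g = 1; as K is commutative,
-- the coefficient products also agree, so S_M is invariant under rotation.
-- For powers, (a) holds for wʳ iff it holds for w, and (b) holds for wʳ iff it
-- holds for w because free groups are torsion free; the coefficient product is
-- multiplicative.  Torsion freeness is proved on reduced words: a cyclically
-- reduced word has reduced, hence non-trivial, powers, while (x m x⁻¹)ʳ is
-- conjugate to mʳ with m shorter.

open import Defs
open import Algebra.Bundles using (CommutativeRing)
open import Data.Nat using (ℕ; zero; suc; _≤_; s≤s)
open import Data.Nat.Properties using (≤-refl; ≤-trans)
open import Data.Fin using (Fin)
import Data.Fin.Properties as FinP
open import Data.Bool using (Bool; true; false; _∧_; not; if_then_else_)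
import Data.Bool.Properties as BoolP
import Data.Product.Properties as ProdP
open import Data.Product using (_,_)
open import Data.List using (List; []; _∷_; _++_; _∷ʳ_; concat; replicate; foldr; length; _∷ʳ′_; initLast)
import Data.List.Properties as ListP
open import Data.List.Relation.Unary.Linked using (Linked; []; [-]; _∷_; head; tail)
open import Function using (case_of_; _∘_)
open import Function.Bundles using (_⇔_; mk⇔)
open import Relation.Nullary using (Dec; yes; no; does; contradiction)
open import Relation.Nullary.Decidable using (dec-true; does-⇔)
open import Relation.Binary.PropositionalEquality
  using (_≡_; _≢_; refl; sym; trans; cong; cong₂; subst; module ≡-Reasoning)

_^_ : ∀ {a} {X : Set a} → List X → ℕ → List X
w ^ r = concat (replicate r w)

module FreeGroupWords {n : ℕ} where
  open ≡-Reasoning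

  inverse : Letter n → Letter n
  inverse (i , b) = i , not b

  inverse-involutive : ∀ (x : Letter n) → inverse (inverse x) ≡ x
  inverse-involutive (i , b) = cong (i ,_) (BoolP.not-involutive b)

  cancels-comm : ∀ (x y : Letter n) → cancels x y ≡ cancels y x
  cancels-comm (i , b) (j , c) =
    cong₂ (λ p q → p ∧ not q) (does-⇔ (mk⇔ sym sym) (i FinP.≟ j) (j FinP.≟ i))
                              (does-⇔ (mk⇔ sym sym) (b BoolP.≟ c) (c BoolP.≟ b))

  cancels-inverseʳ : ∀ (x : Letter n) → cancels x (inverse x) ≡ true
  cancels-inverseʳ (i , true) rewrite dec-true (i FinP.≟ i) refl = refl
  cancels-inverseʳ (i , false) rewrite dec-true (i FinP.≟ i) refl = refl

  cancels-inverseˡ : ∀ (x : Letter n) → cancels (inverse x) x ≡ true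
  cancels-inverseˡ x = trans (cancels-comm (inverse x) x) (cancels-inverseʳ x)

  cancels-self : ∀ (x : Letter n) → cancels x x ≡ false
  cancels-self (i , true) rewrite dec-true (i FinP.≟ i) refl = refl
  cancels-self (i , false) rewrite dec-true (i FinP.≟ i) refl = refl

  cancels⇒inverse : ∀ (x y : Letter n) → cancels x y ≡ true → y ≡ inverse x
  cancels⇒inverse (i , b) (j , c) h with i FinP.≟ j | b BoolP.≟ c
  ... | yes refl | no b≢c = cong (i ,_) (BoolP.¬-not (b≢c ∘ sym))
  ... | yes refl | yes _ = case h of λ ()
  ... | no _ | _ = case h of λ ()

  Reduced : List (Letter n) → Set
  Reduced = Linked (λ x y → cancels x y ≡ false)

  Reduced-prefix : ∀ u {v} → Reduced (u ++ v) → Reduced u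
  Reduced-prefix [] _ = []
  Reduced-prefix (x ∷ []) _ = [-]
  Reduced-prefix (x ∷ y ∷ u) (c ∷ r) = c ∷ Reduced-prefix (y ∷ u) r

  Reduced-join : ∀ u {y v} → Reduced (u ∷ʳ y) → Reduced (y ∷ v) → Reduced (u ++ y ∷ v)
  Reduced-join [] _ r = r
  Reduced-join (x ∷ []) (c ∷ _) r = c ∷ r
  Reduced-join (x ∷ x′ ∷ u) (c ∷ r₁) r = c ∷ Reduced-join (x′ ∷ u) r₁ r

  push-Reduced : ∀ x {t} → Reduced (x ∷ t) → push x t ≡ x ∷ t
  push-Reduced x [-] = refl
  push-Reduced x (c ∷ _) rewrite c = refl

  Reduced-push : ∀ x {t} → Reduced t → Reduced (push x t)
  Reduced-push x [] = [-]
  Reduced-push x {y ∷ t} r with cancels x y in c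
  ... | true = tail r
  ... | false = c ∷ r

  push-inverse-push : ∀ x {t} → Reduced t → push (inverse x) (push x t) ≡ t
  push-inverse-push x [] rewrite cancels-inverseˡ x = refl
  push-inverse-push x {y ∷ t} r with cancels x y in c
  ... | false rewrite cancels-inverseˡ x = refl
  ... | true with cancels⇒inverse x y c
  ...   | refl = push-Reduced (inverse x) r

  push-push-inverse : ∀ x {t} → Reduced t → push x (push (inverse x) t) ≡ t
  push-push-inverse x {t} r =
    subst (λ z → push z (push (inverse x) t) ≡ t) (inverse-involutive x) (push-inverse-push (inverse x) r)

  -- For reduced t, act a t is the reduced form of a ++ t; act a [] is reduce a
  -- definitionally.
  act : List (Letter n) → List (Letter n) → List (Letter n)
  act a t = foldr push t a

  Reduced-act : ∀ a {t} → Reduced t → Reduced (act a t)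
  Reduced-act [] r = r
  Reduced-act (x ∷ a) r = Reduced-push x (Reduced-act a r)

  Reduced-reduce : ∀ a → Reduced (reduce a)
  Reduced-reduce a = Reduced-act a []

  act-++ : ∀ p q t → act (p ++ q) t ≡ act p (act q t)
  act-++ p q t = ListP.foldr-++ push t p q

  act-push : ∀ x {a t} → Reduced a → Reduced t → act (push x a) t ≡ push x (act a t)
  act-push x [] _ = refl
  act-push x {y ∷ a} {t} ra rt with cancels x y in c
  ... | false = refl
  ... | true with cancels⇒inverse x y c
  ...   | refl = sym (push-push-inverse x (Reduced-act a rt))

  act-reduce : ∀ a {t} → Reduced t → act (reduce a) t ≡ act a t
  act-reduce [] _ = refl
  act-reduce (x ∷ a) rt =
    trans (act-push x (Reduced-reduce a) rt) (cong (push x) (act-reduce a rt))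

  act-Reduced : ∀ a {t} → Reduced (a ++ t) → act a t ≡ a ++ t
  act-Reduced [] _ = refl
  act-Reduced (x ∷ a) r =
    trans (cong (push x) (act-Reduced a (tail r))) (push-Reduced x r)

  reduce-Reduced : ∀ {a} → Reduced a → reduce a ≡ a
  reduce-Reduced {a} r =
    trans (act-Reduced a (subst Reduced (sym (ListP.++-identityʳ a)) r)) (ListP.++-identityʳ a)

  inverseWord : List (Letter n) → List (Letter n)
  inverseWord [] = []
  inverseWord (x ∷ a) = inverseWord a ∷ʳ inverse x

  act-inverseWord : ∀ a {t} → Reduced t → act (inverseWord a) (act a t) ≡ t
  act-inverseWord [] _ = refl
  act-inverseWord (x ∷ a) {t} rt = begin
    act (inverseWord a ∷ʳ inverse x) (push x (act a t))      ≡⟨ act-++ (inverseWord a) _ _ ⟩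
    act (inverseWord a) (push (inverse x) (push x (act a t))) ≡⟨ cong (act (inverseWord a)) (push-inverse-push x (Reduced-act a rt)) ⟩
    act (inverseWord a) (act a t)                             ≡⟨ act-inverseWord a rt ⟩
    t                                                         ∎

  reduce-rotate : ∀ p q → reduce (p ++ q) ≡ [] → reduce (q ++ p) ≡ []
  reduce-rotate p q pq≡1 = begin
    reduce (q ++ p)                        ≡⟨ act-++ q p [] ⟩
    act q (reduce p)                       ≡⟨ act-reduce q (Reduced-reduce p) ⟨
    act (reduce q) (reduce p)              ≡⟨ cong (λ z → act z (reduce p)) q≡p⁻¹ ⟩
    act (reduce (inverseWord p)) (reduce p) ≡⟨ act-reduce (inverseWord p) (Reduced-reduce p) ⟩
    act (inverseWord p) (act p [])         ≡⟨ act-inverseWord p [] ⟩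
    []                                     ∎
    where
    q≡p⁻¹ : reduce q ≡ reduce (inverseWord p)
    q≡p⁻¹ = begin
      reduce q                                  ≡⟨ act-inverseWord p (Reduced-reduce q) ⟨
      act (inverseWord p) (act p (reduce q))    ≡⟨ cong (act (inverseWord p)) (act-++ p q []) ⟨
      act (inverseWord p) (reduce (p ++ q))     ≡⟨ cong (act (inverseWord p)) pq≡1 ⟩
      reduce (inverseWord p)                    ∎

  act-^-reduce : ∀ p r {t} → Reduced t → act (p ^ r) t ≡ act (reduce p ^ r) t
  act-^-reduce p zero _ = refl
  act-^-reduce p (suc r) {t} rt = begin
    act (p ++ p ^ r) t                   ≡⟨ act-++ p (p ^ r) t ⟩
    act p (act (p ^ r) t)                ≡⟨ cong (act p) (act-^-reduce p r rt) ⟩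
    act p (act (reduce p ^ r) t)         ≡⟨ act-reduce p (Reduced-act (reduce p ^ r) rt) ⟨
    act (reduce p) (act (reduce p ^ r) t) ≡⟨ act-++ (reduce p) (reduce p ^ r) t ⟨
    act (reduce p ^ suc r) t             ∎

  reduce-^-trivial : ∀ p r → reduce p ≡ [] → reduce (p ^ r) ≡ []
  reduce-^-trivial p zero _ = refl
  reduce-^-trivial p (suc r) p≡1 = begin
    reduce (p ++ p ^ r)     ≡⟨ act-++ p (p ^ r) [] ⟩
    act p (reduce (p ^ r))  ≡⟨ cong (act p) (reduce-^-trivial p r p≡1) ⟩
    reduce p                ≡⟨ p≡1 ⟩
    []                      ∎

  act-^-conjugate : ∀ x m k {t} → Reduced t →
    act ((x ∷ m ∷ʳ inverse x) ^ k) (push x t) ≡ push x (act (m ^ k) t)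
  act-^-conjugate x m zero _ = refl
  act-^-conjugate x m (suc k) {t} rt = begin
    act (a ++ a ^ k) (push x t)                 ≡⟨ act-++ a (a ^ k) _ ⟩
    act a (act (a ^ k) (push x t))              ≡⟨ cong (act a) (act-^-conjugate x m k rt) ⟩
    push x (act (m ∷ʳ inverse x) (push x u))    ≡⟨ cong (push x) (act-++ m (inverse x ∷ []) _) ⟩
    push x (act m (push (inverse x) (push x u))) ≡⟨ cong (push x ∘ act m) (push-inverse-push x (Reduced-act (m ^ k) rt)) ⟩
    push x (act m u)                            ≡⟨ cong (push x) (act-++ m (m ^ k) t) ⟨
    push x (act (m ^ suc k) t)                  ∎
    where
    a = x ∷ m ∷ʳ inverse x
    u = act (m ^ k) t

  reduce-^-conjugate : ∀ x m k → reduce ((x ∷ m ∷ʳ inverse x) ^ k) ≡ [] → reduce (m ^ k) ≡ []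
  reduce-^-conjugate x m k h = begin
    reduce (m ^ k)                                   ≡⟨ push-inverse-push x (Reduced-reduce (m ^ k)) ⟨
    push (inverse x) (push x (reduce (m ^ k)))       ≡⟨ cong (push (inverse x)) (act-^-conjugate x m k []) ⟨
    push (inverse x) (act (a ^ k) (x ∷ []))          ≡⟨ cong (push (inverse x)) (act-reduce (a ^ k) [-]) ⟨
    push (inverse x) (act (reduce (a ^ k)) (x ∷ [])) ≡⟨ cong (λ w → push (inverse x) (act w (x ∷ []))) h ⟩
    push (inverse x) (x ∷ [])                        ≡⟨ push-inverse-push x [] ⟩
    []                                               ∎
    where
    a = x ∷ m ∷ʳ inverse x

  Reduced-^ : ∀ x a → Reduced ((x ∷ a) ∷ʳ x) → ∀ k → Reduced ((x ∷ a) ^ suc k)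
  Reduced-^ x a r zero = subst Reduced (sym (ListP.++-identityʳ (x ∷ a))) (Reduced-prefix (x ∷ a) r)
  Reduced-^ x a r (suc k) = Reduced-join (x ∷ a) r (Reduced-^ x a r k)

  cyclicallyReduced-^-nontrivial : ∀ x a → Reduced ((x ∷ a) ∷ʳ x) → ∀ k → reduce ((x ∷ a) ^ suc k) ≢ []
  cyclicallyReduced-^-nontrivial x a r k h =
    case trans (sym (reduce-Reduced (Reduced-^ x a r k))) h of λ ()

  Reduced-torsion-free : ∀ N {a} → length a ≤ N → Reduced a → ∀ r → reduce (a ^ suc r) ≡ [] → a ≡ []
  Reduced-torsion-free _ {[]} _ _ _ _ = refl
  Reduced-torsion-free (suc N) {x ∷ a} (s≤s |a|≤N) ra r h with initLast a
  ... | [] = contradiction h (cyclicallyReduced-^-nontrivial x [] (cancels-self x ∷ [-]) r)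
  ... | m ∷ʳ′ z with cancels x z in c
  ...   | false = contradiction h (cyclicallyReduced-^-nontrivial x (m ∷ʳ z) cyclic r)
    where
    cyclic : Reduced ((x ∷ m ∷ʳ z) ∷ʳ x)
    cyclic = subst Reduced (sym (cong (x ∷_) (ListP.++-assoc m (z ∷ []) (x ∷ []))))
               (Reduced-join (x ∷ m) ra (trans (cancels-comm z x) c ∷ [-]))
  ...   | true with cancels⇒inverse x z c
  ...     | refl with Reduced-torsion-free N (≤-trans (ListP.length-++-≤ˡ m) |a|≤N)
                        (Reduced-prefix m (tail ra)) r (reduce-^-conjugate x m (suc r) h)
  ...       | refl = case trans (sym (head ra)) (cancels-inverseʳ x) of λ ()

  torsion-free : ∀ p r → reduce (p ^ suc r) ≡ [] → reduce p ≡ []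
  torsion-free p r h =
    Reduced-torsion-free _ ≤-refl (Reduced-reduce p) r (trans (sym (act-^-reduce p (suc r) [])) h)

module Series {c ℓ} (K : CommutativeRing c ℓ) {n d : ℕ} (M : Matrix K n d) where
  module K = CommutativeRing K
  open K using (Carrier; _≈_; _*_; 0#; setoid; *-comm; *-assoc; *-identityˡ; *-cong; zeroˡ)
  open FreeGroupWords {n}
  open import Relation.Binary.Reasoning.Setoid setoid

  source : Alphabet K M → Fin d
  source ((_ , i , _) , _) = i

  groupWord : List (Alphabet K M) → List (Letter n)
  groupWord w = prodWord (groupElems K M w)

  Trivial : List (Alphabet K M) → Set
  Trivial w = reduce (groupWord w) ≡ []

  trivial? : ∀ w → Dec (Trivial w)
  trivial? w = ListP.≡-dec (ProdP.≡-dec FinP._≟_ BoolP._≟_) (reduce (groupWord w)) []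

  admissible : Alphabet K M → List (Alphabet K M) → Bool
  admissible x xs = closedFrom K M (source x) (x ∷ xs) ∧ does (trivial? (x ∷ xs))

  select : Bool → Carrier → Carrier
  select b a = if b then a else 0#

  S-∷ : ∀ x xs → S K M (x ∷ xs) ≡ select (admissible x xs) (coeffProd K M (x ∷ xs))
  S-∷ x xs with closedFrom K M (source x) (x ∷ xs) | trivial? (x ∷ xs)
  ... | true | yes _ = refl
  ... | true | no _ = refl
  ... | false | _ = refl

  groupWord-++ : ∀ u v → groupWord (u ++ v) ≡ groupWord u ++ groupWord v
  groupWord-++ [] v = refl
  groupWord-++ (((g , _) , _) ∷ u) v =
    trans (cong (word g ++_) (groupWord-++ u v)) (sym (ListP.++-assoc (word g) (groupWord u) (groupWord v)))

  groupWord-^ : ∀ w r → groupWord (w ^ r) ≡ groupWord w ^ r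
  groupWord-^ w zero = refl
  groupWord-^ w (suc r) = trans (groupWord-++ w (w ^ r)) (cong (groupWord w ++_) (groupWord-^ w r))

  coeffProd-++ : ∀ u v → coeffProd K M (u ++ v) ≈ coeffProd K M u * coeffProd K M v
  coeffProd-++ [] v = K.sym (*-identityˡ _)
  coeffProd-++ (x ∷ u) v = K.trans (*-cong K.refl (coeffProd-++ u v)) (K.sym (*-assoc _ _ _))

  coeffProd-^ : ∀ w r → coeffProd K M (w ^ r) ≈ powK K (coeffProd K M w) r
  coeffProd-^ w zero = K.refl
  coeffProd-^ w (suc r) = K.trans (coeffProd-++ w (w ^ r)) (*-cong K.refl (coeffProd-^ w r))

  closedFrom-++ : ∀ i x u y v →
    closedFrom K M i (x ∷ u ++ y ∷ v) ≡ closedFrom K M (source y) (x ∷ u) ∧ closedFrom K M i (y ∷ v)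
  closedFrom-++ i x [] y v = refl
  closedFrom-++ i x (x′ ∷ u) y v =
    trans (cong (closedFrom K M (source x′) (x ∷ []) ∧_) (closedFrom-++ i x′ u y v))
      (sym (BoolP.∧-assoc (closedFrom K M (source x′) (x ∷ [])) _ _))

  closedFrom-rotate : ∀ x u y v →
    closedFrom K M (source x) (x ∷ u ++ y ∷ v) ≡ closedFrom K M (source y) (y ∷ v ++ x ∷ u)
  closedFrom-rotate x u y v =
    trans (closedFrom-++ (source x) x u y v)
      (trans (BoolP.∧-comm (closedFrom K M (source y) (x ∷ u)) _)
             (sym (closedFrom-++ (source y) y v x u)))

  closedFrom-^ : ∀ x w r → closedFrom K M (source x) ((x ∷ w) ^ suc r) ≡ closedFrom K M (source x) (x ∷ w)
  closedFrom-^ x w zero = cong (closedFrom K M (source x)) (ListP.++-identityʳ (x ∷ w))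
  closedFrom-^ x w (suc r) =
    trans (closedFrom-++ (source x) x w x (w ++ (x ∷ w) ^ r))
      (trans (cong (closedFrom K M (source x) (x ∷ w) ∧_) (closedFrom-^ x w r))
             (BoolP.∧-idem (closedFrom K M (source x) (x ∷ w))))

  trivial-rotate : ∀ u v → Trivial (u ++ v) → Trivial (v ++ u)
  trivial-rotate u v h rewrite groupWord-++ v u =
    reduce-rotate (groupWord u) (groupWord v) (trans (cong reduce (sym (groupWord-++ u v))) h)

  trivial-^ : ∀ w r → Trivial (w ^ suc r) ⇔ Trivial w
  trivial-^ w r = mk⇔ (torsion-free (groupWord w) r ∘ trans (cong reduce (sym w^r≡)))
                      (trans (cong reduce w^r≡) ∘ reduce-^-trivial (groupWord w) (suc r))
    where
    w^r≡ : groupWord (w ^ suc r) ≡ groupWord w ^ suc r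
    w^r≡ = groupWord-^ w (suc r)

  admissible-rotate : ∀ x u y v → admissible x (u ++ y ∷ v) ≡ admissible y (v ++ x ∷ u)
  admissible-rotate x u y v =
    cong₂ _∧_ (closedFrom-rotate x u y v)
      (does-⇔ (mk⇔ (trivial-rotate (x ∷ u) (y ∷ v)) (trivial-rotate (y ∷ v) (x ∷ u)))
                (trivial? (x ∷ u ++ y ∷ v)) (trivial? (y ∷ v ++ x ∷ u)))

  admissible-^ : ∀ x w r → admissible x (w ++ (x ∷ w) ^ r) ≡ admissible x w
  admissible-^ x w r =
    cong₂ _∧_ (closedFrom-^ x w r) (does-⇔ (trivial-^ (x ∷ w) r) (trivial? ((x ∷ w) ^ suc r)) (trivial? (x ∷ w)))

  select-cong : ∀ b {a a′} → a ≈ a′ → select b a ≈ select b a′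
  select-cong true a≈a′ = a≈a′
  select-cong false _ = K.refl

  select-powK : ∀ b a r → select b (powK K a (suc r)) ≈ powK K (select b a) (suc r)
  select-powK true a r = K.refl
  select-powK false a r = K.sym (zeroˡ _)

  S-rotate : ∀ u v → S K M (u ++ v) ≈ S K M (v ++ u)
  S-rotate [] v = K.reflexive (cong (S K M) (sym (ListP.++-identityʳ v)))
  S-rotate (x ∷ u) [] = K.reflexive (cong (S K M) (ListP.++-identityʳ (x ∷ u)))
  S-rotate (x ∷ u) (y ∷ v) = begin
    S K M (x ∷ u ++ y ∷ v)                                             ≡⟨ S-∷ x (u ++ y ∷ v) ⟩
    select (admissible x (u ++ y ∷ v)) (coeffProd K M (x ∷ u ++ y ∷ v)) ≡⟨ cong (λ b → select b (coeffProd K M (x ∷ u ++ y ∷ v))) (admissible-rotate x u y v) ⟩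
    select b (coeffProd K M ((x ∷ u) ++ y ∷ v))                        ≈⟨ select-cong b (coeffProd-++ (x ∷ u) (y ∷ v)) ⟩
    select b (coeffProd K M (x ∷ u) * coeffProd K M (y ∷ v))           ≈⟨ select-cong b (*-comm _ _) ⟩
    select b (coeffProd K M (y ∷ v) * coeffProd K M (x ∷ u))           ≈⟨ select-cong b (coeffProd-++ (y ∷ v) (x ∷ u)) ⟨
    select b (coeffProd K M (y ∷ v ++ x ∷ u))                          ≡⟨ S-∷ y (v ++ x ∷ u) ⟨
    S K M (y ∷ v ++ x ∷ u)                                             ∎
    where
    b = admissible y (v ++ x ∷ u)

  S-^ : ∀ x w r → S K M ((x ∷ w) ^ suc r) ≈ powK K (S K M (x ∷ w)) (suc r)
  S-^ x w r = begin
    S K M ((x ∷ w) ^ suc r)                                       ≡⟨ S-∷ x (w ++ (x ∷ w) ^ r) ⟩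
    select (admissible x (w ++ (x ∷ w) ^ r)) (coeffProd K M ((x ∷ w) ^ suc r)) ≡⟨ cong (λ b → select b (coeffProd K M ((x ∷ w) ^ suc r))) (admissible-^ x w r) ⟩
    select b (coeffProd K M ((x ∷ w) ^ suc r))                    ≈⟨ select-cong b (coeffProd-^ (x ∷ w) (suc r)) ⟩
    select b (powK K (coeffProd K M (x ∷ w)) (suc r))             ≈⟨ select-powK b _ r ⟩
    powK K (select b (coeffProd K M (x ∷ w))) (suc r)             ≡⟨ cong (λ a → powK K a (suc r)) (S-∷ x w) ⟨
    powK K (S K M (x ∷ w)) (suc r)                                ∎
    where
    b = admissible x w

proposition4p2 : ∀ {c ℓ} (K : CommutativeRing c ℓ) (n d : ℕ) (M : Matrix K n d) →
    IsCyclic K (S K M)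
proposition4p2 K n d M = S-rotate , S-power
  where
  open Series K M
  open CommutativeRing K using (_≈_)

  S-power : ∀ w → w ≢ [] → ∀ r → 2 ≤ r → S K M (w ^ r) ≈ powK K (S K M w) r
  S-power [] w≢[] _ _ = contradiction refl w≢[]
  S-power (x ∷ w) _ (suc r) _ = S-^ x w r
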